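{- Let $n\ge1$ be an integer and $d\ge2$ an even integer. (i) If $\gcd(F_n,F_d)=1$, the embedding dimension of $S_1=\langle F_n,F_{n+d},F_{n+2d},\ldots\rangle$ is \[ \mathbf e(S_1)=\begin{cases}1+\left\lceil\frac{n-2}{d}\right\rceil & \text{if } d=2, \text{ or } d>2 \text{ and } n\le 2,\\ 1+\left\lceil\frac{n-1}{d}\right\rceil & \text{if } d>2 \text{ and } n>2.\end{cases} \] (ii) If $\gcd(L_n,F_d)=1$, the embedding dimension of $S_2=\langle L_n,L_{n+d},L_{n+2d},\ldots\rangle$ is \[ \mathbf e(S_2)=\begin{cases}1 & \text{if } n=1,\\ 1+\left\lceil\frac{n}{d}\right\rceil & \text{if } n>1.\end{cases} \]
   Context: $F_j$ and $L_j$ are the Fibonacci and Lucas numbers ($F_1=F_2=1$, $L_1=1$, $L_2=3$, each satisfying $X_j=X_{j-1}+X_{j-2}$). $\langle A\rangle$ is the set of finite non-negative integer linear combinations of elements of $A$. The embedding dimension $\mathbf e(S)$ of a numerical semigroup $S$ is the cardinality of its minimal generating set $S^\star\setminus(S^\star+S^\star)$, $S^\star=S\setminus\{0\}$. -}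

module Defs where

open import Data.Nat using (ℕ; zero; suc; _+_; _*_)
open import Data.Nat.DivMod using (_/_)
open import Data.Product using (Σ; ∃; _×_; _,_)
open import Data.List using (List; length)
open import Data.List.Membership.Propositional using (_∈_)
open import Data.List.Relation.Unary.Unique.Propositional using (Unique)
open import Relation.Binary.PropositionalEquality using (_≡_; _≢_)
open import Relation.Nullary using (¬_)
open import Function.Bundles using (_⇔_)

fib : ℕ → ℕ
fib zero = zero
fib (suc zero) = 1
fib (suc (suc j)) = fib (suc j) + fib j

lucas : ℕ → ℕ
lucas zero = 2
lucas (suc zero) = 1
lucas (suc (suc j)) = lucas (suc j) + lucas j

-- ⟨ { g k | k ∈ ℕ } ⟩ : finite non-negative integer combinations of the g k,
-- i.e. finite sums (with repetition) of elements g k.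
data Gen (g : ℕ → ℕ) : ℕ → Set where
  gen-zero : Gen g 0
  gen-add  : ∀ k {x} → Gen g x → Gen g (g k + x)

NonZeroElt : (ℕ → Set) → ℕ → Set
NonZeroElt S x = S x × x ≢ 0

MinGen : (ℕ → Set) → ℕ → Set
MinGen S x = NonZeroElt S x ×
  ¬ (Σ ℕ λ a → Σ ℕ λ b → NonZeroElt S a × NonZeroElt S b × x ≡ a + b)

EmbDim : (ℕ → Set) → ℕ → Set
EmbDim S k = Σ (List ℕ) λ xs → Unique xs × length xs ≡ k × (∀ x → (x ∈ xs) ⇔ MinGen S x)

-- ceiling division ⌈ a / d ⌉ for d ≥ 1 (value at d = 0 irrelevant)
ceilDiv : ℕ → ℕ → ℕ
ceilDiv a zero = 0
ceilDiv a (suc e) = (a + e) / suc e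

{-# OPTIONS --safe #-}
-- For even d every sequence with y (k + 2) = y (k + 1) + y k satisfies
-- y (m + 2d) + y m = L_d y (m + d) (Cassini's identity gives the case m = 1), so
-- g k = y (n + k d) solves the Chebyshev recurrence g (k + 2) = L_d g (k + 1) - g k, and
-- F (k d) = F d U k for the Lucas sequence U = U (L_d, 1). For such g with g 0 coprime to g 1
-- and 2 g 0 ≤ g 1, the generator g k is minimal exactly when U k < g 0. If g k splits as a sum
-- of elements, weighting every summand g i by U i gives a total weight w < U k (U i / g i
-- increases with i) while w g 1 ≡ U k g 1 modulo g 0, so g 0 divides U k - w. If g 0 ≤ U k,
-- dividing U k by g 0 exhibits g k - g 0 as an element. The embedding dimension is therefore the
-- number of k with F (k d) < F d y n, and Fibonacci inequalities turn this count into the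
-- stated ceilings.
module Submission where

open import Defs
open import Data.Nat using (ℕ; _+_; _*_; _∸_; _≤_; _<_)
open import Data.Nat.Divisibility using (_∣_)
open import Data.Nat.GCD using (gcd)
open import Data.Product using (_×_)
open import Data.Sum using (_⊎_)
open import Relation.Binary.PropositionalEquality using (_≡_)

open import Algebra.Properties.CommutativeSemigroup as CommSemigroupProperties using ()
open import Data.Empty using (⊥-elim)
open import Data.List using (List; map; upTo)
open import Data.List.Membership.Propositional using (_∈_)
open import Data.List.Membership.Propositional.Properties using (∈-map⁺; ∈-map⁻; ∈-upTo⁺; ∈-upTo⁻)
open import Data.List.Properties using (length-map; length-upTo)
open import Data.List.Relation.Unary.Unique.Propositional.Properties using (map⁺; upTo⁺)
open import Data.Nat using (zero; suc; z≤n; s≤s; z<s; NonZero; >-nonZero; _≟_; _<?_; _/_; _%_)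
open import Data.Nat.Coprimality
  using (Coprime; coprime-divisor; 1-coprimeTo; gcd≡1⇒coprime) renaming (sym to coprime-sym)
open import Data.Nat.DivMod
  using (m≡m%n+[m/n]*n; m%n<n; m<n⇒m/n≡0; m≥n⇒m/n>0; [m+kn]%n≡m%n; %-distribˡ-+; n%n≡0; m*n%n≡0)
open import Data.Nat.Divisibility using (divides; ∣-trans; ∣⇒≤; ∣m+n∣m⇒∣n; ∣n⇒∣m*n)
open import Data.Nat.Properties
open import Data.Nat.Tactic.RingSolver using (solve-∀)
open import Data.Product using (Σ; _,_; proj₁; proj₂)
open import Data.Sum using (inj₁; inj₂)
open import Function.Base using (_∘_)
open import Function.Bundles using (mk⇔)
open import Relation.Binary.PropositionalEquality using (refl; sym; trans; cong; cong₂; subst; subst₂; _≢_; module ≡-Reasoning)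
open import Relation.Nullary using (¬_; yes; no)

open CommSemigroupProperties +-commutativeSemigroup using (interchange)
  renaming (x∙yz≈xz∙y to +-x∙yz≈xz∙y)
open CommSemigroupProperties *-commutativeSemigroup using ()
  renaming (x∙yz≈y∙xz to *-x∙yz≈y∙xz; x∙yz≈yx∙z to *-x∙yz≈yx∙z)

Increasing : (ℕ → ℕ) → Set
Increasing s = ∀ k → s k < s (suc k)

module _ {s : ℕ → ℕ} (inc : Increasing s) where

  increasing⇒< : ∀ {i j} → i < j → s i < s j
  increasing⇒< {i} {suc j} (s≤s i≤j) with m≤n⇒m<n∨m≡n i≤j
  ... | inj₁ i<j  = <-trans (increasing⇒< i<j) (inc j)
  ... | inj₂ refl = inc j

  increasing⇒≤ : ∀ {i j} → i ≤ j → s i ≤ s j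
  increasing⇒≤ i≤j with m≤n⇒m<n∨m≡n i≤j
  ... | inj₁ i<j  = <⇒≤ (increasing⇒< i<j)
  ... | inj₂ refl = ≤-refl

  increasing-reflects-< : ∀ {i j} → s i < s j → i < j
  increasing-reflects-< sᵢ<sⱼ = ≰⇒> (λ j≤i → <⇒≱ sᵢ<sⱼ (increasing⇒≤ j≤i))

  increasing⇒injective : ∀ {i j} → s i ≡ s j → i ≡ j
  increasing⇒injective sᵢ≡sⱼ = ≤-antisym (≮⇒≥ (λ j<i → <⇒≢ (increasing⇒< j<i) (sym sᵢ≡sⱼ)))
                                         (≮⇒≥ (λ i<j → <⇒≢ (increasing⇒< i<j) sᵢ≡sⱼ))

record ChebyshevRec (L : ℕ) (s : ℕ → ℕ) : Set where
  field step : ∀ k → s (2 + k) + s k ≡ L * s (1 + k)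
open ChebyshevRec

module _ {L : ℕ} where

  chebyshev-*ˡ : ∀ {s} c → ChebyshevRec L s → ChebyshevRec L (λ k → c * s k)
  chebyshev-*ˡ {s} c rec .step k = begin
    c * s (2 + k) + c * s k  ≡⟨ *-distribˡ-+ c _ _ ⟨
    c * (s (2 + k) + s k)    ≡⟨ cong (c *_) (rec .step k) ⟩
    c * (L * s (1 + k))      ≡⟨ *-x∙yz≈y∙xz c L _ ⟩
    L * (c * s (1 + k))      ∎
    where open ≡-Reasoning

  chebyshev-+ : ∀ {s t} → ChebyshevRec L s → ChebyshevRec L t → ChebyshevRec L (λ k → s k + t k)
  chebyshev-+ {s} {t} rec-s rec-t .step k = begin
    (s (2 + k) + t (2 + k)) + (s k + t k)  ≡⟨ interchange (s (2 + k)) (t (2 + k)) (s k) (t k) ⟩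
    (s (2 + k) + s k) + (t (2 + k) + t k)  ≡⟨ cong₂ _+_ (rec-s .step k) (rec-t .step k) ⟩
    L * s (1 + k) + L * t (1 + k)          ≡⟨ *-distribˡ-+ L _ _ ⟨
    L * (s (1 + k) + t (1 + k))            ∎
    where open ≡-Reasoning

  chebyshev-shift : ∀ {s} i → ChebyshevRec L s → ChebyshevRec L (λ k → s (i + k))
  chebyshev-shift i rec .step k rewrite +-suc i (suc k) | +-suc i k = rec .step (i + k)

  chebyshev-unique : ∀ {s t} → ChebyshevRec L s → ChebyshevRec L t →
                     s 0 ≡ t 0 → s 1 ≡ t 1 → ∀ k → s k ≡ t k
  chebyshev-unique {s} {t} rec-s rec-t s₀≡t₀ s₁≡t₁ k = proj₁ (agree k)
    where
    open ≡-Reasoning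
    agree : ∀ k → s k ≡ t k × s (1 + k) ≡ t (1 + k)
    agree zero = s₀≡t₀ , s₁≡t₁
    agree (suc k) with agree k
    ... | sₖ≡tₖ , sₖ₊₁≡tₖ₊₁ = sₖ₊₁≡tₖ₊₁ , +-cancelʳ-≡ (s k) _ _ (begin
      s (2 + k) + s k  ≡⟨ rec-s .step k ⟩
      L * s (1 + k)    ≡⟨ cong (L *_) sₖ₊₁≡tₖ₊₁ ⟩
      L * t (1 + k)    ≡⟨ rec-t .step k ⟨
      t (2 + k) + t k  ≡⟨ cong (t (2 + k) +_) sₖ≡tₖ ⟨
      t (2 + k) + s k  ∎)

  -- Constancy of the Casoratian s i t (1 + i) - s (1 + i) t i, written without subtraction.
  chebyshev-casoratian : ∀ {s t} → ChebyshevRec L s → ChebyshevRec L t → ∀ i →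
                         s i * t (1 + i) + s 1 * t 0 ≡ s (1 + i) * t i + s 0 * t 1
  chebyshev-casoratian {s} {t} rec-s rec-t zero = +-comm (s 0 * t 1) (s 1 * t 0)
  chebyshev-casoratian {s} {t} rec-s rec-t (suc i) = +-cancelʳ-≡ (s (1 + i) * t i) _ _ (begin
    s (1 + i) * t (2 + i) + c₁ + s (1 + i) * t i  ≡⟨ factor (s (1 + i)) (t (2 + i)) (t i) c₁ ⟩
    s (1 + i) * (t (2 + i) + t i) + c₁            ≡⟨ cong (λ x → s (1 + i) * x + c₁) (rec-t .step i) ⟩
    s (1 + i) * (L * t (1 + i)) + c₁              ≡⟨ cong (_+ c₁) (*-x∙yz≈yx∙z (s (1 + i)) L _) ⟩
    L * s (1 + i) * t (1 + i) + c₁                ≡⟨ cong (λ x → x * t (1 + i) + c₁) (rec-s .step i) ⟨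
    (s (2 + i) + s i) * t (1 + i) + c₁            ≡⟨ expand (s (2 + i)) (s i) (t (1 + i)) c₁ ⟩
    s (2 + i) * t (1 + i) + (s i * t (1 + i) + c₁) ≡⟨ cong (s (2 + i) * t (1 + i) +_) (chebyshev-casoratian rec-s rec-t i) ⟩
    s (2 + i) * t (1 + i) + (s (1 + i) * t i + c₀) ≡⟨ +-x∙yz≈xz∙y (s (2 + i) * t (1 + i)) (s (1 + i) * t i) c₀ ⟩
    s (2 + i) * t (1 + i) + c₀ + s (1 + i) * t i  ∎)
    where
    open ≡-Reasoning
    c₀ c₁ : ℕ
    c₀ = s 0 * t 1
    c₁ = s 1 * t 0
    factor : ∀ x y z c → x * y + c + x * z ≡ x * (y + z) + c
    factor = solve-∀
    expand : ∀ x y z c → (x + y) * z + c ≡ x * z + (y * z + c)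
    expand = solve-∀

  chebyshev-increasing : 2 ≤ L → ∀ {s} → ChebyshevRec L s → s 0 < s 1 → Increasing s
  chebyshev-increasing 2≤L rec s₀<s₁ zero = s₀<s₁
  chebyshev-increasing 2≤L {s} rec s₀<s₁ (suc k) = +-cancelʳ-< (s k) _ _ (begin-strict
    s (1 + k) + s k          <⟨ +-monoʳ-< (s (1 + k)) (chebyshev-increasing 2≤L rec s₀<s₁ k) ⟩
    s (1 + k) + s (1 + k)    ≡⟨ cong (s (1 + k) +_) (+-identityʳ _) ⟨
    2 * s (1 + k)            ≤⟨ *-monoˡ-≤ (s (1 + k)) 2≤L ⟩
    L * s (1 + k)            ≡⟨ rec .step k ⟨
    s (2 + k) + s k          ∎)
    where open ≤-Reasoning

chebyshev-stride : ∀ {L d} {s : ℕ → ℕ} → (∀ m → s (m + d + d) + s m ≡ L * s (m + d)) →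
                   ∀ n → ChebyshevRec L (λ k → s (n + k * d))
chebyshev-stride {L} {d} {s} rec n .step k =
  subst₂ (λ i j → s i + s (n + k * d) ≡ L * s j) (two-strides n (k * d) d) (one-stride n (k * d) d) (rec (n + k * d))
  where
  two-strides : ∀ n x d → n + x + d + d ≡ n + (d + (d + x))
  two-strides = solve-∀
  one-stride : ∀ n x d → n + x + d ≡ n + (d + x)
  one-stride = solve-∀

-- The Lucas sequence U (L, 1); its truncated subtraction is exact when 2 ≤ L (see lucasU-rec).
lucasU : ℕ → ℕ → ℕ
lucasU L zero = 0
lucasU L (suc zero) = 1
lucasU L (suc (suc k)) = L * lucasU L (suc k) ∸ lucasU L k

module _ {L : ℕ} (2≤L : 2 ≤ L) where

  lucasU-monotone : ∀ k → lucasU L k ≤ lucasU L (suc k)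
  lucasU-monotone zero = z≤n
  lucasU-monotone (suc k) = m+n≤o⇒m≤o∸n (lucasU L (suc k)) (begin
    lucasU L (suc k) + lucasU L k          ≤⟨ +-monoʳ-≤ (lucasU L (suc k)) (lucasU-monotone k) ⟩
    lucasU L (suc k) + lucasU L (suc k)    ≡⟨ cong (lucasU L (suc k) +_) (+-identityʳ _) ⟨
    2 * lucasU L (suc k)                   ≤⟨ *-monoˡ-≤ (lucasU L (suc k)) 2≤L ⟩
    L * lucasU L (suc k)                   ∎)
    where open ≤-Reasoning

  lucasU-rec : ChebyshevRec L (lucasU L)
  lucasU-rec .step k = m∸n+n≡m (≤-trans (lucasU-monotone k) (m≤n*m (lucasU L (suc k)) L {{L-nonZero}}))
    where
    L-nonZero : NonZero L
    L-nonZero = >-nonZero (<-≤-trans z<s 2≤L)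

module _ {g : ℕ → ℕ} where

  gen-generator : ∀ k → Gen g (g k)
  gen-generator k = subst (Gen g) (+-identityʳ (g k)) (gen-add k gen-zero)

  gen-+ : ∀ {a b} → Gen g a → Gen g b → Gen g (a + b)
  gen-+ gen-zero D = D
  gen-+ {b = b} (gen-add k {a} C) D = subst (Gen g) (sym (+-assoc (g k) a b)) (gen-add k (gen-+ C D))

  gen-multiple : ∀ m k → Gen g (m * g k)
  gen-multiple zero k = gen-zero
  gen-multiple (suc m) k = gen-add k (gen-multiple m k)

Decomposable : (ℕ → Set) → ℕ → Set
Decomposable S x = Σ ℕ λ a → Σ ℕ λ b → NonZeroElt S a × NonZeroElt S b × x ≡ a + b

%-cong-+ : ∀ {a a′ b b′ n} .{{_ : NonZero n}} →
           a % n ≡ a′ % n → b % n ≡ b′ % n → (a + b) % n ≡ (a′ + b′) % n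
%-cong-+ {a} {a′} {b} {b′} {n} a≡a′ b≡b′ = begin
  (a + b) % n              ≡⟨ %-distribˡ-+ a b n ⟩
  (a % n + b % n) % n      ≡⟨ cong₂ (λ x y → (x + y) % n) a≡a′ b≡b′ ⟩
  (a′ % n + b′ % n) % n    ≡⟨ %-distribˡ-+ a′ b′ n ⟨
  (a′ + b′) % n            ∎
  where open ≡-Reasoning

%≡%⇒∣∸ : ∀ m n {d} .{{_ : NonZero d}} → m % d ≡ n % d → d ∣ m ∸ n
%≡%⇒∣∸ m n {d} m%d≡n%d = divides (m / d ∸ n / d) (begin
  m ∸ n                                  ≡⟨ cong₂ _∸_ (m≡m%n+[m/n]*n m d) (m≡m%n+[m/n]*n n d) ⟩
  (m % d + m / d * d) ∸ (n % d + n / d * d) ≡⟨ cong (λ x → (x + m / d * d) ∸ (n % d + n / d * d)) m%d≡n%d ⟩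
  (n % d + m / d * d) ∸ (n % d + n / d * d) ≡⟨ [m+n]∸[m+o]≡n∸o (n % d) _ _ ⟩
  m / d * d ∸ n / d * d                  ≡⟨ *-distribʳ-∸ d (m / d) (n / d) ⟨
  (m / d ∸ n / d) * d                    ∎)
  where open ≡-Reasoning

module EmbeddingDimension {L : ℕ} (2≤L : 2 ≤ L) (g : ℕ → ℕ) (g-rec : ChebyshevRec L g)
  (g₀>0 : 0 < g 0) (g₀+g₀≤g₁ : g 0 + g 0 ≤ g 1) (g₀⊥g₁ : Coprime (g 0) (g 1)) where

  private
    U : ℕ → ℕ
    U = lucasU L
    instance
      g₀-nonZero : NonZero (g 0)
      g₀-nonZero = >-nonZero g₀>0

  g-increasing : Increasing g
  g-increasing = chebyshev-increasing 2≤L g-rec (<-≤-trans (m<m+n (g 0) g₀>0) g₀+g₀≤g₁)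

  U-increasing : Increasing U
  U-increasing = chebyshev-increasing 2≤L (lucasU-rec 2≤L) z<s

  g-nonZero : ∀ k → g k ≢ 0
  g-nonZero k = m<n⇒n≢0 (<-≤-trans g₀>0 (increasing⇒≤ g-increasing z≤n))

  cross : ∀ i m → g i * U (i + m) ≡ U i * g (i + m) + g 0 * U m
  cross i = chebyshev-unique {s = λ m → g i * U (i + m)} {t = λ m → U i * g (i + m) + g 0 * U m}
    (chebyshev-*ˡ (g i) (chebyshev-shift i (lucasU-rec 2≤L)))
    (chebyshev-+ (chebyshev-*ˡ (U i) (chebyshev-shift i g-rec)) (chebyshev-*ˡ (g 0) (lucasU-rec 2≤L)))
    at-0 at-1
    where
    open ≡-Reasoning
    at-0 : g i * U (i + 0) ≡ U i * g (i + 0) + g 0 * 0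
    at-0 rewrite +-identityʳ i | *-zeroʳ (g 0) | +-identityʳ (U i * g i) = *-comm (g i) (U i)
    at-1 : g i * U (i + 1) ≡ U i * g (i + 1) + g 0 * 1
    at-1 rewrite +-comm i 1 = begin
      g i * U (1 + i)                  ≡⟨ +-identityʳ _ ⟨
      g i * U (1 + i) + 0              ≡⟨ cong (g i * U (1 + i) +_) (*-zeroʳ (g 1)) ⟨
      g i * U (1 + i) + g 1 * 0        ≡⟨ chebyshev-casoratian g-rec (lucasU-rec 2≤L) i ⟩
      g (1 + i) * U i + g 0 * 1        ≡⟨ cong (_+ g 0 * 1) (*-comm (g (1 + i)) (U i)) ⟩
      U i * g (1 + i) + g 0 * 1        ∎

  cross-one : ∀ k → g (1 + k) + U k * g 0 ≡ U (1 + k) * g 1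
  cross-one k = begin
    g (1 + k) + U k * g 0      ≡⟨ cong₂ _+_ (*-identityˡ (g (1 + k))) (*-comm (g 0) (U k)) ⟨
    1 * g (1 + k) + g 0 * U k  ≡⟨ cross 1 k ⟨
    g 1 * U (1 + k)            ≡⟨ *-comm (g 1) _ ⟩
    U (1 + k) * g 1            ∎
    where open ≡-Reasoning

  cross-< : ∀ {i k} → i < k → g k * U i < g i * U k
  cross-< {i} {k} i<k with m≤n⇒∃[o]m+o≡n i<k
  ... | o , refl = begin-strict
    g (suc i + o) * U i                     ≡⟨ cong (λ j → g j * U i) (+-suc i o) ⟨
    g (i + suc o) * U i                     ≡⟨ *-comm _ (U i) ⟩
    U i * g (i + suc o)                     <⟨ m<m+n _ (*-mono-< g₀>0 (increasing⇒< U-increasing (z<s {o}))) ⟩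
    U i * g (i + suc o) + g 0 * U (suc o)   ≡⟨ cross i (suc o) ⟨
    g i * U (i + suc o)                     ≡⟨ cong (λ j → g i * U j) (+-suc i o) ⟩
    g i * U (suc i + o)                     ∎
    where open ≤-Reasoning

  weight : ∀ {v} → Gen g v → ℕ
  weight gen-zero = 0
  weight (gen-add i D) = U i + weight D

  weight-bound        : ∀ {k v} (D : Gen g v) → v < g k → g k * weight D ≤ v * U k
  weight-bound-strict : ∀ {k v} (D : Gen g v) → v ≢ 0 → v < g k → g k * weight D < v * U k

  weight-bound {k} gen-zero _ = ≤-reflexive (*-zeroʳ (g k))
  weight-bound (gen-add i D) v<gₖ = <⇒≤ (weight-bound-strict (gen-add i D) (g-nonZero i ∘ m+n≡0⇒m≡0 (g i)) v<gₖ)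

  weight-bound-strict gen-zero v≢0 _ = ⊥-elim (v≢0 refl)
  weight-bound-strict {k} (gen-add i {v} D) _ gᵢ+v<gₖ = begin-strict
    g k * (U i + weight D)        ≡⟨ *-distribˡ-+ (g k) (U i) (weight D) ⟩
    g k * U i + g k * weight D    <⟨ +-mono-<-≤ (cross-< i<k) (weight-bound D (≤-<-trans (m≤n+m v (g i)) gᵢ+v<gₖ)) ⟩
    g i * U k + v * U k           ≡⟨ *-distribʳ-+ (U k) (g i) v ⟨
    (g i + v) * U k               ∎
    where
    open ≤-Reasoning
    i<k : i < k
    i<k = increasing-reflects-< g-increasing (≤-<-trans (m≤m+n (g i) v) gᵢ+v<gₖ)

  generator-mod : ∀ k → g k % g 0 ≡ U k * g 1 % g 0
  generator-mod zero = trans (n%n≡0 (g 0)) (sym (m*n%n≡0 0 (g 0)))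
  generator-mod (suc k) = begin
    g (1 + k) % g 0                   ≡⟨ [m+kn]%n≡m%n (g (1 + k)) (U k) (g 0) ⟨
    (g (1 + k) + U k * g 0) % g 0     ≡⟨ cong (_% g 0) (cross-one k) ⟩
    U (1 + k) * g 1 % g 0             ∎
    where open ≡-Reasoning

  weight-mod : ∀ {v} (D : Gen g v) → v % g 0 ≡ weight D * g 1 % g 0
  weight-mod gen-zero = refl
  weight-mod (gen-add i D) = trans (%-cong-+ {a′ = U i * g 1} {b′ = weight D * g 1} (generator-mod i) (weight-mod D))
                                   (cong (_% g 0) (sym (*-distribʳ-+ (g 1) (U i) (weight D))))

  generator-irreducible : ∀ {k} → U k < g 0 → ¬ Decomposable (Gen g) (g k)
  generator-irreducible {k} Uₖ<g₀ (a , b , (Da , a≢0) , (Db , b≢0) , gₖ≡a+b) = <⇒≱ Uₖ<g₀ g₀≤Uₖ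
    where
    w : ℕ
    w = weight Da + weight Db
    a<gₖ : a < g k
    a<gₖ = subst (a <_) (sym gₖ≡a+b) (m<m+n a (n≢0⇒n>0 b≢0))
    b<gₖ : b < g k
    b<gₖ = subst (b <_) (trans (+-comm b a) (sym gₖ≡a+b)) (m<m+n b (n≢0⇒n>0 a≢0))
    w<Uₖ : w < U k
    w<Uₖ = *-cancelˡ-< (g k) w (U k) (begin-strict
      g k * w                              ≡⟨ *-distribˡ-+ (g k) (weight Da) (weight Db) ⟩
      g k * weight Da + g k * weight Db   <⟨ +-mono-<-≤ (weight-bound-strict Da a≢0 a<gₖ) (weight-bound Db b<gₖ) ⟩
      a * U k + b * U k                    ≡⟨ *-distribʳ-+ (U k) a b ⟨
      (a + b) * U k                        ≡⟨ cong (_* U k) gₖ≡a+b ⟨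
      g k * U k                            ∎)
      where open ≤-Reasoning
    same-residue : U k * g 1 % g 0 ≡ w * g 1 % g 0
    same-residue = begin
      U k * g 1 % g 0                              ≡⟨ generator-mod k ⟨
      g k % g 0                                    ≡⟨ cong (_% g 0) gₖ≡a+b ⟩
      (a + b) % g 0
        ≡⟨ %-cong-+ {a′ = weight Da * g 1} {b′ = weight Db * g 1} (weight-mod Da) (weight-mod Db) ⟩
      (weight Da * g 1 + weight Db * g 1) % g 0   ≡⟨ cong (_% g 0) (*-distribʳ-+ (g 1) (weight Da) (weight Db)) ⟨
      w * g 1 % g 0                                ∎
      where open ≡-Reasoning
    g₀∣gap : g 0 ∣ U k ∸ w
    g₀∣gap = coprime-divisor g₀⊥g₁ (subst (g 0 ∣_) gap-product (%≡%⇒∣∸ (U k * g 1) (w * g 1) same-residue))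
      where
      gap-product : U k * g 1 ∸ w * g 1 ≡ g 1 * (U k ∸ w)
      gap-product = trans (sym (*-distribʳ-∸ (g 1) (U k) w)) (*-comm (U k ∸ w) (g 1))
    g₀≤Uₖ : g 0 ≤ U k
    g₀≤Uₖ = ≤-trans (∣⇒≤ {{>-nonZero (m<n⇒0<n∸m w<Uₖ)}} g₀∣gap) (m∸n≤m (U k) w)

  -- Write U (1 + k) = r + t g₀ with r < g₀; then g (1 + k) = r g₁ + (t g₁ - U k) g₀ and t g₁ > U k.
  generator-reducible : ∀ k → g 0 ≤ U k → Decomposable (Gen g) (g k)
  generator-reducible zero g₀≤0 = ⊥-elim (<⇒≱ g₀>0 g₀≤0)
  generator-reducible (suc k) g₀≤Uₖ₊₁ =
    g 0 , rest , (gen-generator 0 , g-nonZero 0) , (gen-+ (gen-multiple r 1) (gen-multiple o 0) , rest≢0) , gₖ₊₁≡g₀+rest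
    where
    r t : ℕ
    r = U (1 + k) % g 0
    t = U (1 + k) / g 0
    euclid : U (1 + k) ≡ r + t * g 0
    euclid = m≡m%n+[m/n]*n (U (1 + k)) (g 0)
    Uₖ<tg₁ : U k < t * g 1
    Uₖ<tg₁ = begin-strict
      U k                 <⟨ U-increasing k ⟩
      U (1 + k)           ≡⟨ euclid ⟩
      r + t * g 0         <⟨ +-monoˡ-< (t * g 0) (m%n<n (U (1 + k)) (g 0)) ⟩
      g 0 + t * g 0       ≤⟨ +-monoˡ-≤ (t * g 0) (m≤n*m (g 0) t {{>-nonZero (m≥n⇒m/n>0 g₀≤Uₖ₊₁)}}) ⟩
      t * g 0 + t * g 0   ≡⟨ *-distribˡ-+ t (g 0) (g 0) ⟨
      t * (g 0 + g 0)     ≤⟨ *-monoʳ-≤ t g₀+g₀≤g₁ ⟩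
      t * g 1             ∎
      where open ≤-Reasoning
    o rest : ℕ
    o = proj₁ (m≤n⇒∃[o]m+o≡n Uₖ<tg₁)
    rest = r * g 1 + o * g 0
    gₖ₊₁≡g₀+rest : g (1 + k) ≡ g 0 + rest
    gₖ₊₁≡g₀+rest = +-cancelʳ-≡ (U k * g 0) _ _ (begin
      g (1 + k) + U k * g 0          ≡⟨ cross-one k ⟩
      U (1 + k) * g 1                ≡⟨ cong (_* g 1) euclid ⟩
      (r + t * g 0) * g 1            ≡⟨ expand r t (g 0) (g 1) ⟩
      r * g 1 + g 0 * (t * g 1)      ≡⟨ cong (λ x → r * g 1 + g 0 * x) (proj₂ (m≤n⇒∃[o]m+o≡n Uₖ<tg₁)) ⟨
      r * g 1 + g 0 * (suc (U k) + o) ≡⟨ regroup r (g 1) (g 0) (U k) o ⟩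
      g 0 + rest + U k * g 0         ∎)
      where
      open ≡-Reasoning
      expand : ∀ r t b c → (r + t * b) * c ≡ r * c + b * (t * c)
      expand = solve-∀
      regroup : ∀ r c b u o → r * c + b * (suc u + o) ≡ b + (r * c + o * b) + u * b
      regroup = solve-∀
    rest≢0 : rest ≢ 0
    rest≢0 rest≡0 = <⇒≢ (increasing⇒< g-increasing (z<s {k}))
      (sym (trans gₖ₊₁≡g₀+rest (trans (cong (g 0 +_) rest≡0) (+-identityʳ (g 0)))))

  embDim : ∀ c → U c < g 0 → g 0 ≤ U (suc c) → EmbDim (Gen g) (suc c)
  embDim c Uc<g₀ g₀≤U₁₊c =
    generators , map⁺ (increasing⇒injective g-increasing) (upTo⁺ (suc c)) ,
    trans (length-map g (upTo (suc c))) (length-upTo (suc c)) , λ x → mk⇔ member⇒minGen minGen⇒member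
    where
    generators : List ℕ
    generators = map g (upTo (suc c))
    member⇒minGen : ∀ {x} → x ∈ generators → MinGen (Gen g) x
    member⇒minGen x∈ with ∈-map⁻ g x∈
    ... | k , k∈ , refl = (gen-generator k , g-nonZero k) ,
      generator-irreducible (≤-<-trans (increasing⇒≤ U-increasing (≤-pred (∈-upTo⁻ k∈))) Uc<g₀)
    minGen⇒member : ∀ {x} → MinGen (Gen g) x → x ∈ generators
    minGen⇒member ((gen-zero , x≢0) , _) = ⊥-elim (x≢0 refl)
    minGen⇒member ((gen-add k {y} D , _) , indecomposable) with y ≟ 0
    ... | no y≢0 = ⊥-elim (indecomposable (g k , y , (gen-generator k , g-nonZero k) , (D , y≢0) , refl))
    ... | yes refl with k <? suc c
    ...   | yes k≤c = subst (_∈ generators) (sym (+-identityʳ (g k))) (∈-map⁺ g (∈-upTo⁺ k≤c))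
    ...   | no k>c  = ⊥-elim (indecomposable (subst (Decomposable (Gen g)) (sym (+-identityʳ (g k)))
                        (generator-reducible k (≤-trans g₀≤U₁₊c (increasing⇒≤ U-increasing (≮⇒≥ k>c))))))

record FibonacciRec (y : ℕ → ℕ) : Set where
  field step : ∀ k → y (2 + k) ≡ y (1 + k) + y k
open FibonacciRec

fib-rec : FibonacciRec fib
fib-rec .step _ = refl

lucas-rec : FibonacciRec lucas
lucas-rec .step _ = refl

module _ {y : ℕ → ℕ} (y-rec : FibonacciRec y) where

  fibonacci-add : ∀ j m → y (m + suc j) ≡ fib (suc j) * y (suc m) + fib j * y m
  fibonacci-add zero m = trans (cong y (+-comm m 1)) (sym (trans (+-identityʳ _) (+-identityʳ _)))
  fibonacci-add (suc j) m = begin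
    y (m + suc (suc j))                                   ≡⟨ cong y (+-suc m (suc j)) ⟩
    y (suc m + suc j)                                     ≡⟨ fibonacci-add j (suc m) ⟩
    fib (suc j) * y (2 + m) + fib j * y (suc m)           ≡⟨ cong (λ x → fib (suc j) * x + fib j * y (suc m)) (y-rec .step m) ⟩
    fib (suc j) * (y (1 + m) + y m) + fib j * y (suc m)   ≡⟨ regroup (fib (suc j)) (fib j) (y (suc m)) (y m) ⟩
    (fib (suc j) + fib j) * y (suc m) + fib (suc j) * y m ∎
    where
    open ≡-Reasoning
    regroup : ∀ a b u v → a * (u + v) + b * u ≡ (a + b) * u + a * v
    regroup = solve-∀

  fibonacci-monotone : ∀ {i j} → i ≤ j → y (suc i) ≤ y (suc j)
  fibonacci-monotone {j = zero} z≤n = ≤-refl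
  fibonacci-monotone {i} {suc j} i≤1+j with m≤n⇒m<n∨m≡n i≤1+j
  ... | inj₁ (s≤s i≤j) = ≤-trans (fibonacci-monotone i≤j) (subst (y (suc j) ≤_) (sym (y-rec .step j)) (m≤m+n _ _))
  ... | inj₂ refl = ≤-refl

  fibonacci-positive : 0 < y 1 → ∀ k → 0 < y (suc k)
  fibonacci-positive y₁>0 k = <-≤-trans y₁>0 (fibonacci-monotone z≤n)

  fibonacci-coprime : Coprime (y 0) (y 1) → ∀ k → Coprime (y k) (y (suc k))
  fibonacci-coprime y₀⊥y₁ zero = y₀⊥y₁
  fibonacci-coprime y₀⊥y₁ (suc k) (i∣yₖ₊₁ , i∣yₖ₊₂) =
    fibonacci-coprime y₀⊥y₁ k (∣m+n∣m⇒∣n (subst (_ ∣_) (y-rec .step k) i∣yₖ₊₂) i∣yₖ₊₁ , i∣yₖ₊₁)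

fib-add : ∀ j m → fib (m + suc j) ≡ fib (suc j) * fib (suc m) + fib j * fib m
fib-add = fibonacci-add fib-rec

fib-monotone : ∀ {i j} → i ≤ j → fib i ≤ fib j
fib-monotone {zero} _ = z≤n
fib-monotone {suc i} {suc j} (s≤s i≤j) = fibonacci-monotone fib-rec i≤j

fib-positive : ∀ k → 0 < fib (suc k)
fib-positive = fibonacci-positive fib-rec z<s

fib[2+k]<fib[3+k] : ∀ k → fib (2 + k) < fib (3 + k)
fib[2+k]<fib[3+k] k = m<m+n (fib (2 + k)) (fib-positive k)

lucas-positive : ∀ k → 0 < lucas k
lucas-positive zero = z<s
lucas-positive (suc k) = fibonacci-positive lucas-rec z<s k

lucas≡fib+fib : ∀ m → lucas (suc m) ≡ fib m + fib (2 + m)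
lucas≡fib+fib m = trans (fibonacci-add lucas-rec m 0) (regroup (fib (suc m)) (fib m))
  where
  regroup : ∀ a b → a * 1 + b * 2 ≡ b + (a + b)
  regroup = solve-∀

fib-double : ∀ d → fib (d + d) ≡ lucas d * fib d
fib-double zero = refl
fib-double (suc e) = begin
  fib (suc e + suc e)                                ≡⟨ fib-add e (suc e) ⟩
  fib (suc e) * fib (2 + e) + fib e * fib (suc e)    ≡⟨ regroup (fib (suc e)) (fib (2 + e)) (fib e) ⟩
  (fib e + fib (2 + e)) * fib (suc e)                ≡⟨ cong (_* fib (suc e)) (lucas≡fib+fib e) ⟨
  lucas (suc e) * fib (suc e)                        ∎
  where
  open ≡-Reasoning
  regroup : ∀ a c b → a * c + b * a ≡ (b + c) * a
  regroup = solve-∀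

fib-cassini-sum : ∀ m → fib (1 + m) * fib (3 + m) + fib m * fib (2 + m) ≡
                        fib (1 + m) * fib (1 + m) + fib (2 + m) * fib (2 + m)
fib-cassini-sum m = identity (fib (1 + m)) (fib m)
  where
  identity : ∀ a b → a * ((a + b) + a) + b * (a + b) ≡ a * a + (a + b) * (a + b)
  identity = solve-∀

fib-cassini-odd  : ∀ p → fib (p * 2) * fib (2 + p * 2) + 1 ≡ fib (1 + p * 2) * fib (1 + p * 2)
fib-cassini-even : ∀ p → fib (1 + p * 2) * fib (3 + p * 2) ≡ fib (2 + p * 2) * fib (2 + p * 2) + 1

fib-cassini-odd zero = refl
fib-cassini-odd (suc p) = +-cancelʳ-≡ (F₂ * F₂) _ _ (begin
  F₂ * F₄ + 1 + F₂ * F₂     ≡⟨ +-assoc (F₂ * F₄) 1 (F₂ * F₂) ⟩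
  F₂ * F₄ + (1 + F₂ * F₂)   ≡⟨ cong (F₂ * F₄ +_) (trans (+-comm 1 (F₂ * F₂)) (sym (fib-cassini-even p))) ⟩
  F₂ * F₄ + F₁ * F₃         ≡⟨ fib-cassini-sum (1 + p * 2) ⟩
  F₂ * F₂ + F₃ * F₃         ≡⟨ +-comm (F₂ * F₂) (F₃ * F₃) ⟩
  F₃ * F₃ + F₂ * F₂         ∎)
  where
  open ≡-Reasoning
  F₁ F₂ F₃ F₄ : ℕ
  F₁ = fib (1 + p * 2)
  F₂ = fib (2 + p * 2)
  F₃ = fib (3 + p * 2)
  F₄ = fib (4 + p * 2)

fib-cassini-even p = +-cancelʳ-≡ (F₀ * F₂) _ _ (begin
  F₁ * F₃ + F₀ * F₂         ≡⟨ fib-cassini-sum (p * 2) ⟩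
  F₁ * F₁ + F₂ * F₂         ≡⟨ cong (_+ F₂ * F₂) (fib-cassini-odd p) ⟨
  F₀ * F₂ + 1 + F₂ * F₂     ≡⟨ swap (F₀ * F₂) (F₂ * F₂) ⟩
  F₂ * F₂ + 1 + F₀ * F₂     ∎)
  where
  open ≡-Reasoning
  F₀ F₁ F₂ F₃ : ℕ
  F₀ = fib (p * 2)
  F₁ = fib (1 + p * 2)
  F₂ = fib (2 + p * 2)
  F₃ = fib (3 + p * 2)
  swap : ∀ a b → a + 1 + b ≡ b + 1 + a
  swap = solve-∀

coprime-*ʳ : ∀ {m a b} → Coprime m a → Coprime m b → Coprime m (a * b)
coprime-*ʳ {m} {a} m⊥a m⊥b (i∣m , i∣ab) = m⊥b (i∣m , coprime-divisor i⊥a i∣ab)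
  where
  i⊥a : Coprime _ a
  i⊥a (j∣i , j∣a) = m⊥a (∣-trans j∣i i∣m , j∣a)

coprime-+-* : ∀ {m n} k → Coprime m n → Coprime m (n + k * m)
coprime-+-* {m} {n} k m⊥n {i} (i∣m , i∣n+km) =
  m⊥n (i∣m , ∣m+n∣m⇒∣n (subst (i ∣_) (+-comm n (k * m)) i∣n+km) (∣n⇒∣m*n k i∣m))

ceilDiv-zero : ∀ e → ceilDiv 0 (suc e) ≡ 0
ceilDiv-zero e = m<n⇒m/n≡0 (n<1+n e)

ceilDiv-upper : ∀ a e → ceilDiv a (suc e) * suc e ≤ a + e
ceilDiv-upper a e = subst (ceilDiv a (suc e) * suc e ≤_) (sym (m≡m%n+[m/n]*n (a + e) (suc e)))
                          (m≤n+m _ ((a + e) % suc e))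

ceilDiv-lower : ∀ a e → a ≤ ceilDiv a (suc e) * suc e
ceilDiv-lower a e = +-cancelʳ-≤ e a _ (begin
  a + e                                       ≡⟨ m≡m%n+[m/n]*n (a + e) (suc e) ⟩
  (a + e) % suc e + ceilDiv a (suc e) * suc e ≤⟨ +-monoˡ-≤ _ (≤-pred (m%n<n (a + e) (suc e))) ⟩
  e + ceilDiv a (suc e) * suc e               ≡⟨ +-comm e _ ⟩
  ceilDiv a (suc e) * suc e + e               ∎)
  where open ≤-Reasoning

fib*fib≤fib : ∀ j n → fib (suc j) * fib (suc n) ≤ fib (n + suc j)
fib*fib≤fib j n = subst (fib (suc j) * fib (suc n) ≤_) (sym (fib-add j n)) (m≤m+n _ (fib j * fib n))

fib<fib*fib : ∀ j n → 1 ≤ j → 2 ≤ n → fib (n + suc j) < fib (2 + j) * fib (suc n)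
fib<fib*fib (suc i) (suc zero) _ (s≤s ())
fib<fib*fib (suc i) (suc (suc m)) _ _ = begin-strict
  fib (n + suc j)                                 ≡⟨ fib-add j n ⟩
  fib (suc j) * fib (suc n) + fib j * fib (2 + m) <⟨ +-monoʳ-< _ (*-monoʳ-< (fib j) {{fib-j-nonZero}} (fib[2+k]<fib[3+k] m)) ⟩
  fib (suc j) * fib (suc n) + fib j * fib (suc n) ≡⟨ *-distribʳ-+ (fib (suc n)) (fib (suc j)) (fib j) ⟨
  fib (2 + j) * fib (suc n)               ∎
  where
  open ≤-Reasoning
  j n : ℕ
  j = suc i
  n = suc (suc m)
  fib-j-nonZero : NonZero (fib j)
  fib-j-nonZero = >-nonZero (fib-positive i)

fib<fib*lucas : ∀ j n → 1 ≤ n → fib (n + suc j) < fib (suc j) * lucas (suc n)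
fib<fib*lucas j (suc m) _ = begin-strict
  fib (n + suc j)                                 ≡⟨ fib-add j n ⟩
  fib (suc j) * fib (suc n) + fib j * fib n       <⟨ +-mono-<-≤ (*-monoʳ-< (fib (suc j)) {{fib-1+j-nonZero}} (fib[2+k]<fib[3+k] m))
                                                                 (*-monoˡ-≤ (fib n) (fib-monotone (n≤1+n j))) ⟩
  fib (suc j) * fib (2 + n) + fib (suc j) * fib n ≡⟨ *-distribˡ-+ (fib (suc j)) (fib (2 + n)) (fib n) ⟨
  fib (suc j) * (fib (2 + n) + fib n)             ≡⟨ cong (fib (suc j) *_) (+-comm (fib (2 + n)) (fib n)) ⟩
  fib (suc j) * (fib n + fib (2 + n))             ≡⟨ cong (fib (suc j) *_) (lucas≡fib+fib n) ⟨
  fib (suc j) * lucas (suc n)                     ∎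
  where
  open ≤-Reasoning
  n : ℕ
  n = suc m
  fib-1+j-nonZero : NonZero (fib (suc j))
  fib-1+j-nonZero = >-nonZero (fib-positive j)

fib*lucas≤fib : ∀ j n → fib (suc j) * lucas (suc n) ≤ fib (suc n + suc (suc j))
fib*lucas≤fib j n = begin
  fib (suc j) * lucas (suc n)                          ≡⟨ cong (fib (suc j) *_) (lucas≡fib+fib n) ⟩
  fib (suc j) * (fib n + fib (2 + n))                  ≡⟨ *-distribˡ-+ (fib (suc j)) (fib n) (fib (2 + n)) ⟩
  fib (suc j) * fib n + fib (suc j) * fib (2 + n)      ≤⟨ +-mono-≤ (*-monoʳ-≤ (fib (suc j)) (fib-monotone (n≤1+n n)))
                                                                   (*-monoˡ-≤ (fib (2 + n)) (fib-monotone (n≤1+n (suc j)))) ⟩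
  fib (suc j) * fib (suc n) + fib (2 + j) * fib (2 + n) ≡⟨ +-comm (fib (suc j) * fib (suc n)) _ ⟩
  fib (2 + j) * fib (2 + n) + fib (suc j) * fib (suc n) ≡⟨ fib-add (suc j) (suc n) ⟨
  fib (suc n + suc (suc j))                            ∎
  where open ≤-Reasoning

module EvenStride (p : ℕ) where

  d : ℕ
  d = suc p * 2

  L : ℕ
  L = lucas d

  2≤L : 2 ≤ L
  2≤L = +-mono-≤ (lucas-positive (1 + p * 2)) (lucas-positive (p * 2))

  instance
    fib-d-nonZero : NonZero (fib d)
    fib-d-nonZero = >-nonZero (fib-positive (1 + p * 2))

  fib-even-step : ∀ m → fib (m + d + d) + fib m ≡ L * fib (m + d)
  fib-even-step zero = trans (+-identityʳ _) (fib-double d)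
  fib-even-step (suc zero) = begin
    fib (suc (d + d)) + 1                                      ≡⟨ cong (λ i → fib i + 1) (+-suc d d) ⟨
    fib (d + suc d) + 1                                        ≡⟨ cong (_+ 1) (fib-add d d) ⟩
    fib (1 + d) * fib (1 + d) + fib d * fib d + 1              ≡⟨ +-assoc (fib (1 + d) * fib (1 + d)) (fib d * fib d) 1 ⟩
    fib (1 + d) * fib (1 + d) + (fib d * fib d + 1)            ≡⟨ cong (fib (1 + d) * fib (1 + d) +_) (fib-cassini-even p) ⟨
    fib (1 + d) * fib (1 + d) + fib (1 + p * 2) * fib (1 + d)  ≡⟨ *-distribʳ-+ (fib (1 + d)) (fib (1 + d)) (fib (1 + p * 2)) ⟨
    (fib (1 + d) + fib (1 + p * 2)) * fib (1 + d)              ≡⟨ cong (_* fib (1 + d)) (+-comm (fib (1 + d)) _) ⟩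
    (fib (1 + p * 2) + fib (1 + d)) * fib (1 + d)              ≡⟨ cong (_* fib (1 + d)) (lucas≡fib+fib (1 + p * 2)) ⟨
    L * fib (1 + d)                                            ∎
    where open ≡-Reasoning
  fib-even-step (suc (suc m)) = begin
    fib (2 + m + d + d) + fib (2 + m)
      ≡⟨ interchange (fib (1 + m + d + d)) (fib (m + d + d)) (fib (1 + m)) (fib m) ⟩
    (fib (1 + m + d + d) + fib (1 + m)) + (fib (m + d + d) + fib m)
      ≡⟨ cong₂ _+_ (fib-even-step (suc m)) (fib-even-step m) ⟩
    L * fib (1 + m + d) + L * fib (m + d)
      ≡⟨ *-distribˡ-+ L (fib (1 + m + d)) (fib (m + d)) ⟨
    L * fib (2 + m + d)
      ∎
    where open ≡-Reasoning

  fibonacci-even-step : ∀ {y} → FibonacciRec y → ∀ m → y (suc m + d + d) + y (suc m) ≡ L * y (suc m + d)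
  fibonacci-even-step {y} y-rec m = begin
    y (suc (m + d + d)) + y (suc m)
      ≡⟨ cong₂ _+_ (initial (m + d + d)) (initial m) ⟩
    (fib (suc (m + d + d)) * y 1 + fib (m + d + d) * y 0) + (fib (suc m) * y 1 + fib m * y 0)
      ≡⟨ regroup (fib (suc (m + d + d))) (fib (m + d + d)) (fib (suc m)) (fib m) (y 1) (y 0) ⟩
    (fib (suc m + d + d) + fib (suc m)) * y 1 + (fib (m + d + d) + fib m) * y 0
      ≡⟨ cong₂ (λ a b → a * y 1 + b * y 0) (fib-even-step (suc m)) (fib-even-step m) ⟩
    L * fib (suc m + d) * y 1 + L * fib (m + d) * y 0
      ≡⟨ factor L (fib (suc m + d)) (fib (m + d)) (y 1) (y 0) ⟩
    L * (fib (suc (m + d)) * y 1 + fib (m + d) * y 0)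
      ≡⟨ cong (L *_) (initial (m + d)) ⟨
    L * y (suc (m + d))
      ∎
    where
    open ≡-Reasoning
    initial : ∀ k → y (suc k) ≡ fib (suc k) * y 1 + fib k * y 0
    initial k = fibonacci-add y-rec k 0
    regroup : ∀ a b c e u v → (a * u + b * v) + (c * u + e * v) ≡ (a + c) * u + (b + e) * v
    regroup = solve-∀
    factor : ∀ l x z u v → l * x * u + l * z * v ≡ l * (x * u + z * v)
    factor = solve-∀

  fib-multiple : ∀ k → fib (k * d) ≡ fib d * lucasU L k
  fib-multiple = chebyshev-unique {s = λ k → fib (k * d)} (chebyshev-stride {d = d} {s = fib} fib-even-step 0)
    (chebyshev-*ˡ (fib d) (lucasU-rec 2≤L)) (sym (*-zeroʳ (fib d)))
    (trans (cong fib (+-identityʳ d)) (sym (*-identityʳ (fib d))))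

  fib*lucas+fib≡fib : ∀ m → fib d * lucas (m + d) + fib m ≡ fib (m + d + d)
  fib*lucas+fib≡fib zero = trans (+-identityʳ _) (trans (*-comm (fib d) L) (sym (fib-double d)))
  fib*lucas+fib≡fib (suc zero) = begin
    fib d * lucas (1 + d) + 1                         ≡⟨ cong (λ x → fib d * x + 1) (lucas≡fib+fib d) ⟩
    fib d * (fib d + fib (2 + d)) + 1                 ≡⟨ regroup (fib d) (fib (2 + d)) ⟩
    fib d * fib d + (fib d * fib (2 + d) + 1)         ≡⟨ cong (fib d * fib d +_) (fib-cassini-odd (suc p)) ⟩
    fib d * fib d + fib (1 + d) * fib (1 + d)         ≡⟨ +-comm (fib d * fib d) _ ⟩
    fib (1 + d) * fib (1 + d) + fib d * fib d         ≡⟨ fib-add d d ⟨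
    fib (d + suc d)                                   ≡⟨ cong fib (+-suc d d) ⟩
    fib (suc (d + d))                                 ∎
    where
    open ≡-Reasoning
    regroup : ∀ a b → a * (a + b) + 1 ≡ a * a + (a * b + 1)
    regroup = solve-∀
  fib*lucas+fib≡fib (suc (suc m)) = begin
    fib d * lucas (2 + m + d) + fib (2 + m)
      ≡⟨ cong (_+ fib (2 + m)) (*-distribˡ-+ (fib d) (lucas (1 + m + d)) (lucas (m + d))) ⟩
    (fib d * lucas (1 + m + d) + fib d * lucas (m + d)) + (fib (1 + m) + fib m)
      ≡⟨ interchange (fib d * lucas (1 + m + d)) (fib d * lucas (m + d)) (fib (1 + m)) (fib m) ⟩
    (fib d * lucas (1 + m + d) + fib (1 + m)) + (fib d * lucas (m + d) + fib m)
      ≡⟨ cong₂ _+_ (fib*lucas+fib≡fib (suc m)) (fib*lucas+fib≡fib m) ⟩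
    fib (2 + m + d + d)
      ∎
    where open ≡-Reasoning

  fib*lucas≤fib-even : ∀ n → d ≤ n → fib d * lucas n ≤ fib (n + d)
  fib*lucas≤fib-even n d≤n with m≤n⇒∃[o]m+o≡n d≤n
  ... | o , refl = subst (λ n → fib d * lucas n ≤ fib (n + d)) (+-comm o d)
                     (subst (fib d * lucas (o + d) ≤_) (fib*lucas+fib≡fib o) (m≤m+n _ (fib o)))

  embDim-stride : ∀ {y} → FibonacciRec y → Coprime (y 0) (y 1) → 0 < y 1 → ∀ n c →
                  Coprime (y (suc n)) (fib d) →
                  fib (c * d) < fib d * y (suc n) → fib d * y (suc n) ≤ fib (suc c * d) →
                  EmbDim (Gen (λ k → y (suc n + k * d))) (suc c)
  embDim-stride {y} y-rec y₀⊥y₁ y₁>0 n c yₙ⊥F_d below above =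
    embDim c (*-cancelˡ-< (fib d) _ _ (subst₂ _<_ (fib-multiple c) (cong (fib d *_) (sym g₀≡yₙ)) below))
             (*-cancelˡ-≤ (fib d) (subst₂ _≤_ (cong (fib d *_) (sym g₀≡yₙ)) (fib-multiple (suc c)) above))
    where
    g : ℕ → ℕ
    g k = y (suc n + k * d)
    g₀≡yₙ : g 0 ≡ y (suc n)
    g₀≡yₙ = cong (λ i → y (suc i)) (+-identityʳ n)
    g₁≡yₙ₊d : g 1 ≡ y (suc n + d)
    g₁≡yₙ₊d = cong (λ i → y (suc n + i)) (+-identityʳ d)
    g₀>0 : 0 < g 0
    g₀>0 = subst (0 <_) (sym g₀≡yₙ) (fibonacci-positive y-rec y₁>0 n)
    g₀+g₀≤g₁ : g 0 + g 0 ≤ g 1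
    g₀+g₀≤g₁ = subst₂ (λ a b → a + a ≤ b) (sym g₀≡yₙ) (sym g₁≡yₙ₊d) (begin
      y (1 + n) + y (1 + n)  ≤⟨ +-monoˡ-≤ (y (1 + n)) (fibonacci-monotone y-rec (n≤1+n n)) ⟩
      y (2 + n) + y (1 + n)  ≡⟨ y-rec .step (suc n) ⟨
      y (3 + n)              ≤⟨ fibonacci-monotone y-rec 2+n≤n+d ⟩
      y (suc n + d)          ∎)
      where
      open ≤-Reasoning
      2+n≤n+d : 2 + n ≤ n + d
      2+n≤n+d = subst (2 + n ≤_) (+-comm d n) (+-monoˡ-≤ n (s≤s (s≤s z≤n)))
    g₀⊥g₁ : Coprime (g 0) (g 1)
    g₀⊥g₁ = subst₂ Coprime (sym g₀≡yₙ) (sym (trans g₁≡yₙ₊d (fibonacci-add y-rec (1 + p * 2) (suc n))))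
      (coprime-+-* (fib (1 + p * 2)) (coprime-*ʳ yₙ⊥F_d (fibonacci-coprime y-rec y₀⊥y₁ (suc n))))
    open EmbeddingDimension 2≤L g (chebyshev-stride {s = λ m → y (suc m)} (fibonacci-even-step y-rec) n)
                                  g₀>0 g₀+g₀≤g₁ g₀⊥g₁

  embDim-stride-one : ∀ {y} → FibonacciRec y → Coprime (y 0) (y 1) → 0 < y 1 → ∀ n → y (suc n) ≡ 1 →
                      EmbDim (Gen (λ k → y (suc n + k * d))) 1
  embDim-stride-one {y} y-rec y₀⊥y₁ y₁>0 n yₙ≡1 = embDim-stride y-rec y₀⊥y₁ y₁>0 n 0 yₙ⊥F_d below above
    where
    F_d*yₙ≡F_d : fib d * y (suc n) ≡ fib d
    F_d*yₙ≡F_d = trans (cong (fib d *_) yₙ≡1) (*-identityʳ (fib d))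
    yₙ⊥F_d : Coprime (y (suc n)) (fib d)
    yₙ⊥F_d = subst (λ x → Coprime x (fib d)) (sym yₙ≡1) (1-coprimeTo (fib d))
    below : 0 < fib d * y (suc n)
    below = subst (0 <_) (sym F_d*yₙ≡F_d) (fib-positive (1 + p * 2))
    above : fib d * y (suc n) ≤ fib (d + 0)
    above = ≤-reflexive (trans F_d*yₙ≡F_d (cong fib (sym (+-identityʳ d))))

fib₀⊥fib₁ : Coprime (fib 0) (fib 1)
fib₀⊥fib₁ = coprime-sym (1-coprimeTo 0)

lucas₀⊥lucas₁ : Coprime (lucas 0) (lucas 1)
lucas₀⊥lucas₁ = coprime-sym (1-coprimeTo 2)

embDim-fib-stride-two : ∀ m → Coprime (fib (3 + m)) (fib 2) →
                        EmbDim (Gen (λ k → fib (3 + m + k * 2))) (1 + ceilDiv (1 + m) 2)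
embDim-fib-stride-two m fₙ⊥f₂ = embDim-stride fib-rec fib₀⊥fib₁ z<s (2 + m) c fₙ⊥f₂ below above
  where
  open EvenStride 0
  c : ℕ
  c = ceilDiv (1 + m) 2
  below : fib (c * 2) < 1 * fib (3 + m)
  below = begin-strict
    fib (c * 2)      ≤⟨ fib-monotone (ceilDiv-upper (1 + m) 1) ⟩
    fib (1 + m + 1)  ≡⟨ cong fib (+-comm (1 + m) 1) ⟩
    fib (2 + m)      <⟨ fib[2+k]<fib[3+k] m ⟩
    fib (3 + m)      ≡⟨ *-identityˡ (fib (3 + m)) ⟨
    1 * fib (3 + m)  ∎
    where open ≤-Reasoning
  above : 1 * fib (3 + m) ≤ fib (2 + c * 2)
  above = ≤-trans (≤-reflexive (*-identityˡ (fib (3 + m)))) (fib-monotone (+-monoʳ-≤ 2 (ceilDiv-lower (1 + m) 1)))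

embDim-fib-short : ∀ p n → Coprime (fib (suc n)) (fib (suc p * 2)) →
                   (suc p * 2 ≡ 2 ⊎ (2 < suc p * 2 × suc n ≤ 2)) →
                   EmbDim (Gen (λ k → fib (suc n + k * (suc p * 2)))) (1 + ceilDiv (suc n ∸ 2) (suc p * 2))
embDim-fib-short p zero _ _ rewrite ceilDiv-zero (1 + p * 2) =
  EvenStride.embDim-stride-one p fib-rec fib₀⊥fib₁ z<s 0 refl
embDim-fib-short p (suc zero) _ _ rewrite ceilDiv-zero (1 + p * 2) =
  EvenStride.embDim-stride-one p fib-rec fib₀⊥fib₁ z<s 1 refl
embDim-fib-short p (suc (suc n)) _ (inj₂ (_ , s≤s (s≤s ())))
embDim-fib-short zero (suc (suc n)) fₙ⊥f₂ (inj₁ refl) = embDim-fib-stride-two n fₙ⊥f₂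
embDim-fib-short (suc p) (suc (suc n)) _ (inj₁ ())

embDim-fib-long : ∀ p n → Coprime (fib (suc n)) (fib (suc p * 2)) → (2 < suc p * 2 × 2 < suc n) →
                  EmbDim (Gen (λ k → fib (suc n + k * (suc p * 2)))) (1 + ceilDiv (suc n ∸ 1) (suc p * 2))
embDim-fib-long zero _ _ (s≤s (s≤s ()) , _)
embDim-fib-long (suc p) n fₙ⊥f_d (_ , s≤s 2≤n) = embDim-stride fib-rec fib₀⊥fib₁ z<s n c fₙ⊥f_d below above
  where
  open EvenStride (suc p)
  c : ℕ
  c = ceilDiv n d
  below : fib (c * d) < fib d * fib (suc n)
  below = ≤-<-trans (fib-monotone (ceilDiv-upper n (3 + p * 2))) (fib<fib*fib (2 + p * 2) n z<s 2≤n)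
  above : fib d * fib (suc n) ≤ fib (d + c * d)
  above = ≤-trans (fib*fib≤fib (3 + p * 2) n)
                  (fib-monotone (≤-trans (+-monoˡ-≤ d (ceilDiv-lower n (3 + p * 2))) (≤-reflexive (+-comm (c * d) d))))

embDim-lucas-one : ∀ p n → suc n ≡ 1 → EmbDim (Gen (λ k → lucas (suc n + k * (suc p * 2)))) 1
embDim-lucas-one p zero refl = EvenStride.embDim-stride-one p lucas-rec lucas₀⊥lucas₁ z<s 0 refl

embDim-lucas : ∀ p n → Coprime (lucas (suc n)) (fib (suc p * 2)) → 1 < suc n →
               EmbDim (Gen (λ k → lucas (suc n + k * (suc p * 2)))) (1 + ceilDiv (suc n) (suc p * 2))
embDim-lucas p n lₙ⊥f_d (s≤s 1≤n) = embDim-stride lucas-rec lucas₀⊥lucas₁ z<s n c lₙ⊥f_d below above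
  where
  open EvenStride p
  c : ℕ
  c = ceilDiv (suc n) d
  below : fib (c * d) < fib d * lucas (suc n)
  below = begin-strict
    fib (c * d)               ≤⟨ fib-monotone (ceilDiv-upper (suc n) (1 + p * 2)) ⟩
    fib (suc n + (1 + p * 2)) ≡⟨ cong fib (+-suc n (1 + p * 2)) ⟨
    fib (n + d)               <⟨ fib<fib*lucas (1 + p * 2) n 1≤n ⟩
    fib d * lucas (suc n)     ∎
    where open ≤-Reasoning
  d≤multiple : ∀ c → suc n ≡ c * d → d ≤ suc n
  d≤multiple (suc c) n≡cd = subst (d ≤_) (sym n≡cd) (m≤m+n d (c * d))
  -- F d L n ≤ F (n + d + 1) suffices unless n = c d, where F d L n + F (n - d) = F (n + d) is needed.
  above : fib d * lucas (suc n) ≤ fib (d + c * d)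
  above with m≤n⇒m<n∨m≡n (ceilDiv-lower (suc n) (1 + p * 2))
  ... | inj₁ n<cd = ≤-trans (fib*lucas≤fib (1 + p * 2) n) (fib-monotone (begin
    suc n + suc d  ≡⟨ +-suc (suc n) d ⟩
    suc (suc n) + d ≤⟨ +-monoˡ-≤ d n<cd ⟩
    c * d + d      ≡⟨ +-comm (c * d) d ⟩
    d + c * d      ∎))
    where open ≤-Reasoning
  ... | inj₂ n≡cd = ≤-trans (fib*lucas≤fib-even (suc n) (d≤multiple c n≡cd))
                            (fib-monotone (≤-reflexive (trans (+-comm (suc n) d) (cong (d +_) n≡cd))))

corollary3p1p2 : (n d : ℕ) → 1 ≤ n → 2 ≤ d → 2 ∣ d →
    ((gcd (fib n) (fib d) ≡ 1 →
        ((d ≡ 2 ⊎ (2 < d × n ≤ 2)) →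
           EmbDim (Gen (λ k → fib (n + k * d))) (1 + ceilDiv (n ∸ 2) d))
      × ((2 < d × 2 < n) →
           EmbDim (Gen (λ k → fib (n + k * d))) (1 + ceilDiv (n ∸ 1) d)))
    × (gcd (lucas n) (fib d) ≡ 1 →
        ((n ≡ 1 → EmbDim (Gen (λ k → lucas (n + k * d))) 1)
      × (1 < n → EmbDim (Gen (λ k → lucas (n + k * d))) (1 + ceilDiv n d)))))
corollary3p1p2 zero _ () _ _
corollary3p1p2 (suc n) _ _ () (divides zero refl)
corollary3p1p2 (suc n) _ _ _ (divides (suc p) refl) =
  (λ gcd≡1 → embDim-fib-short p n (gcd≡1⇒coprime gcd≡1) , embDim-fib-long p n (gcd≡1⇒coprime gcd≡1)) ,
  (λ gcd≡1 → embDim-lucas-one p n , embDim-lucas p n (gcd≡1⇒coprime gcd≡1))
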